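{- For every microscopic set $X\subseteq 2^\omega$ and every porous set $E\subseteq 2^\omega$ we have $X+E\neq 2^\omega$.
   Context: $2^\omega$ is the Cantor space with coordinatewise addition modulo 2; $X+E=\{x+e:x\in X,e\in E\}$; $[\sigma]=\{x\in2^\omega:\sigma\subseteq x\}$. $X$ is microscopic if for every $k\in\mathbb{N}$ there is a sequence $(\sigma_n)_{n\geq 1}$ of finite binary sequences with $|\sigma_n|=kn$ and $X\subseteq\bigcup_n[\sigma_n]$. $E$ is porous if there exists $k$ such that for every $m$ and every $\alpha\in 2^m$ there is $\beta\in 2^{m+k}$ with $\alpha\subseteq\beta$ and $[\beta]\cap E=\emptyset$. -}

module Defs where

open import Data.Bool using (Bool; _xor_)
open import Data.Nat using (ℕ; _+_; _*_; _≤_)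
open import Data.Fin using (Fin; toℕ; _↑ˡ_)
open import Data.Vec using (Vec; lookup)
open import Data.Product using (Σ; ∃; _×_)
open import Data.Empty using (⊥)
open import Relation.Nullary using (¬_)
open import Relation.Binary.PropositionalEquality using (_≡_)

Cantor : Set
Cantor = ℕ → Bool

CSet : Set₁
CSet = Cantor → Set

_⊕_ : Cantor → Cantor → Cantor
(x ⊕ y) n = x n xor y n

_≈_ : Cantor → Cantor → Set
x ≈ y = ∀ n → x n ≡ y n

_+ˢ_ : CSet → CSet → CSet
(X +ˢ E) z = Σ Cantor λ x → Σ Cantor λ e → X x × E e × (z ≈ (x ⊕ e))

Cyl : ∀ {m} → Vec Bool m → CSet
Cyl {m} σ x = ∀ (i : Fin m) → lookup σ i ≡ x (toℕ i)

Prefix : ∀ {m k} → Vec Bool m → Vec Bool (m + k) → Set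
Prefix {m} {k} α β = ∀ (i : Fin m) → lookup α i ≡ lookup β (i ↑ˡ k)

-- X is microscopic: for every k there are σ_n (n ≥ 1), |σ_n| = k n, X ⊆ ⋃_n [σ_n]
-- (σ 0 is an unused dummy entry)
Microscopic : CSet → Set
Microscopic X = ∀ (k : ℕ) → Σ ((n : ℕ) → Vec Bool (k * n)) λ σ →
  ∀ x → X x → Σ ℕ λ n → (1 ≤ n) × Cyl (σ n) x

Porous : CSet → Set
Porous E = Σ ℕ λ k → ∀ (m : ℕ) (α : Vec Bool m) →
  Σ (Vec Bool (m + k)) λ β → Prefix α β × (∀ y → Cyl β y → E y → ⊥)

{-# OPTIONS --safe #-}
-- Fix the porosity constant k of E and the strings σ n of length k n covering X.  Build z
-- in stages: if p n is the current approximation, choose a string β n of length k (n + 1)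
-- extending the first k n bits of p n + σ (n + 1) whose cylinder misses E, and let p (n + 1)
-- agree with β n + σ (n + 1) on its first k (n + 1) bits.  The stages agree on longer and
-- longer initial segments, so they converge to some z.  If z = x + e with x ∈ [σ (n + 1)],
-- then e = z + x starts with β n, so e ∉ E.
module Submission where

open import Data.Bool using (Bool; false; _xor_)
open import Data.Bool.Properties using (xor-assoc; xor-same; xor-identityʳ)
open import Data.Empty using (⊥)
open import Data.Fin using (toℕ; fromℕ<; _↑ˡ_) renaming (zero to fzero; suc to fsuc)
open import Data.Fin.Properties using (toℕ-fromℕ<; toℕ-↑ˡ; toℕ<n)
open import Data.Nat using (ℕ; zero; suc; _+_; _*_; _≤_; _<_; _≤′_; ≤′-refl; ≤′-step)
open import Data.Nat.Properties
  using (<-≤-trans; ≤-reflexive; *-monoʳ-≤; *-suc; +-comm; m≤m+n; m≤m⊔n; m≤n⊔m; ≤′⇒≤; ≤⇒≤′)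
open import Data.Product using (Σ; _×_; _,_; proj₁; proj₂)
open import Data.Vec using (Vec; []; _∷_; lookup; tabulate)
open import Data.Vec.Properties using (lookup∘tabulate)
open import Function using (_∘_)
open import Relation.Nullary using (¬_)
open import Relation.Binary.PropositionalEquality using (_≡_; refl; sym; trans; cong; cong₂; module ≡-Reasoning)

open import Defs

private
  variable
    k m n : ℕ
    x y z : Cantor

xor-cancelʳ : ∀ a b → (a xor b) xor b ≡ a
xor-cancelʳ a b = begin
  (a xor b) xor b ≡⟨ xor-assoc a b b ⟩
  a xor (b xor b) ≡⟨ cong (a xor_) (xor-same b) ⟩
  a xor false     ≡⟨ xor-identityʳ a ⟩
  a               ∎
  where open ≡-Reasoning

xor-cancelˡ : ∀ a b → a xor (a xor b) ≡ b
xor-cancelˡ a b = begin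
  a xor (a xor b) ≡⟨ xor-assoc a a b ⟨
  (a xor a) xor b ≡⟨ cong (_xor b) (xor-same a) ⟩
  b               ∎
  where open ≡-Reasoning

infix 4 _≈[_]_

_≈[_]_ : Cantor → ℕ → Cantor → Set
x ≈[ m ] y = ∀ i → i < m → x i ≡ y i

≈[]-refl : x ≈[ m ] x
≈[]-refl _ _ = refl

≈[]-trans : x ≈[ m ] y → y ≈[ m ] z → x ≈[ m ] z
≈[]-trans x≈y y≈z i i<m = trans (x≈y i i<m) (y≈z i i<m)

≈[]-mono : m ≤ n → x ≈[ n ] y → x ≈[ m ] y
≈[]-mono m≤n x≈y i i<m = x≈y i (<-≤-trans i<m m≤n)

pad : Vec Bool m → Cantor
pad []      _       = false
pad (a ∷ σ) zero    = a
pad (a ∷ σ) (suc i) = pad σ i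

Cyl-pad : (σ : Vec Bool m) → Cyl σ (pad σ)
Cyl-pad (a ∷ σ) fzero    = refl
Cyl-pad (a ∷ σ) (fsuc i) = Cyl-pad σ i

restrict : (m : ℕ) → Cantor → Vec Bool m
restrict m x = tabulate (x ∘ toℕ)

Cyl-restrict : ∀ m x → Cyl (restrict m x) x
Cyl-restrict m x = lookup∘tabulate (x ∘ toℕ)

Cyl-agree : (σ : Vec Bool m) → Cyl σ x → Cyl σ y → x ≈[ m ] y
Cyl-agree {x = x} {y = y} σ σx σy i i<m = begin
  x i         ≡⟨ cong x (toℕ-fromℕ< i<m) ⟨
  x (toℕ j)   ≡⟨ σx j ⟨
  lookup σ j  ≡⟨ σy j ⟩
  y (toℕ j)   ≡⟨ cong y (toℕ-fromℕ< i<m) ⟩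
  y i         ∎
  where
  open ≡-Reasoning
  j = fromℕ< i<m

Cyl-resp-≈[] : (σ : Vec Bool m) → Cyl σ x → x ≈[ m ] y → Cyl σ y
Cyl-resp-≈[] σ σx x≈y j = trans (σx j) (x≈y (toℕ j) (toℕ<n j))

Cyl-prefix : (α : Vec Bool m) (β : Vec Bool (m + k)) → Prefix α β → Cyl β x → Cyl α x
Cyl-prefix {k = k} {x = x} α β α⊆β βx j = trans (α⊆β j) (trans (βx (j ↑ˡ k)) (cong x (toℕ-↑ˡ j k)))

i<k*n⇒i<k*[1+i] : ∀ k i → i < k * n → i < k * suc i
i<k*n⇒i<k*[1+i] zero    i ()
i<k*n⇒i<k*[1+i] (suc k) i _ = m≤m+n (suc i) (k * suc i)

module Limit (k : ℕ) (p : ℕ → Cantor) (cauchy : ∀ n → p (suc n) ≈[ k * n ] p n) where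

  -- Bit i is already settled at stage i + 1, since i < k * n forces k ≠ 0.
  lim : Cantor
  lim i = p (suc i) i

  stable : m ≤′ n → p n ≈[ k * m ] p m
  stable ≤′-refl           = ≈[]-refl
  stable (≤′-step {n} m≤n) =
    ≈[]-trans (≈[]-mono (*-monoʳ-≤ k (≤′⇒≤ m≤n)) (cauchy n)) (stable m≤n)

  lim-≈ : ∀ n → lim ≈[ k * n ] p n
  lim-≈ n i i<k*n = trans
    (sym (stable (≤⇒≤′ (m≤n⊔m n (suc i))) i (i<k*n⇒i<k*[1+i] k i i<k*n)))
    (stable (≤⇒≤′ (m≤m⊔n n (suc i))) i i<k*n)

PorousWith : ℕ → CSet → Set
PorousWith k E = ∀ (m : ℕ) (α : Vec Bool m) →
  Σ (Vec Bool (m + k)) λ β → Prefix α β × (∀ y → Cyl β y → E y → ⊥)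

module Escape {E : CSet} (porous : PorousWith k E) (σ : (n : ℕ) → Vec Bool (k * n)) where

  s : ℕ → Cantor
  s n = pad (σ n)

  mutual
    p : ℕ → Cantor
    p zero    _ = false
    p (suc n)   = pad (β n) ⊕ s (suc n)

    α : (n : ℕ) → Vec Bool (k * n)
    α n = restrict (k * n) (p n ⊕ s (suc n))

    β : (n : ℕ) → Vec Bool (k * n + k)
    β n = proj₁ (porous (k * n) (α n))

  β-extends : ∀ n → Prefix (α n) (β n)
  β-extends n = proj₁ (proj₂ (porous (k * n) (α n)))

  β-avoids : ∀ n y → Cyl (β n) y → ¬ E y
  β-avoids n = proj₂ (proj₂ (porous (k * n) (α n)))

  cauchy : ∀ n → p (suc n) ≈[ k * n ] p n
  cauchy n i i<k*n = begin
    pad (β n) i xor s (suc n) i             ≡⟨ cong (_xor s (suc n) i) (pad≈ i i<k*n) ⟩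
    (p n i xor s (suc n) i) xor s (suc n) i ≡⟨ xor-cancelʳ (p n i) (s (suc n) i) ⟩
    p n i                                   ∎
    where
    open ≡-Reasoning
    pad≈ : pad (β n) ≈[ k * n ] p n ⊕ s (suc n)
    pad≈ = Cyl-agree (α n)
      (Cyl-prefix {x = pad (β n)} (α n) (β n) (β-extends n) (Cyl-pad (β n)))
      (Cyl-restrict (k * n) (p n ⊕ s (suc n)))

  open Limit k p cauchy public using (lim; lim-≈)

  escapes : ∀ e → E e → ∀ n → 1 ≤ n → ¬ Cyl (σ n) (lim ⊕ e)
  escapes e e∈E (suc n) _ σ∋lim⊕e = β-avoids n e (Cyl-resp-≈[] (β n) (Cyl-pad (β n)) pad≈e) e∈E
    where
    k[1+n]≡k*n+k : k * suc n ≡ k * n + k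
    k[1+n]≡k*n+k = trans (*-suc k n) (+-comm k (k * n))

    pad≈e : pad (β n) ≈[ k * n + k ] e
    pad≈e i i<k*n+k = begin
      pad (β n) i                 ≡⟨ xor-cancelʳ (pad (β n) i) (s (suc n) i) ⟨
      p (suc n) i xor s (suc n) i ≡⟨ cong₂ _xor_ (lim≈p i i<) (lim⊕e≈s i i<) ⟨
      lim i xor (lim i xor e i)   ≡⟨ xor-cancelˡ (lim i) (e i) ⟩
      e i                         ∎
      where
      open ≡-Reasoning
      i< : i < k * suc n
      i< = <-≤-trans i<k*n+k (≤-reflexive (sym k[1+n]≡k*n+k))
      lim≈p : lim ≈[ k * suc n ] p (suc n)
      lim≈p = lim-≈ (suc n)
      lim⊕e≈s : lim ⊕ e ≈[ k * suc n ] s (suc n)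
      lim⊕e≈s = Cyl-agree (σ (suc n)) σ∋lim⊕e (Cyl-pad (σ (suc n)))

porous-translate-avoids :
  {E : CSet} → PorousWith k E → (σ : (n : ℕ) → Vec Bool (k * n)) →
  Σ Cantor λ z → ∀ e → E e → ∀ n → 1 ≤ n → ¬ Cyl (σ n) (z ⊕ e)
porous-translate-avoids porous σ = lim , escapes
  where open Escape porous σ

mainTheorem12 : (X E : CSet) → Microscopic X → Porous E
    → ¬ (∀ (z : Cantor) → (X +ˢ E) z)
mainTheorem12 X E microscopic (k , porous) X+E-full
  with σ , σ-covers ← microscopic k
  with z , z+E-avoids ← porous-translate-avoids porous σ
  with x , e , x∈X , e∈E , z≈x⊕e ← X+E-full z
  with n , 1≤n , σn∋x ← σ-covers x x∈X
  = z+E-avoids e e∈E n 1≤n (Cyl-resp-≈[] (σ n) σn∋x x≈z⊕e)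
  where
  x≈z⊕e : x ≈[ k * n ] z ⊕ e
  x≈z⊕e i _ = trans (sym (xor-cancelʳ (x i) (e i))) (cong (_xor e i) (sym (z≈x⊕e i)))
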